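{- Let $d\ge 2$ and let $P'$ be the poset obtained from the Boolean lattice $\mathbf{2}^d$ (equivalently, subsets of $\{1,\dots,d\}$ ordered by inclusion) by deleting its top and bottom elements. Then the maximum size of a chain in $P'$ is $d-1$, and in the ordered chain game on $P'$, Walker can build a chain of size $d-1$, even if Blocker moves first.
   Context: In the ordered chain game (Walker-Blocker game) on a finite poset, Walker and Blocker alternately choose previously unchosen elements until all are chosen (normally Walker moves first; here Blocker may move first). Walker builds a chain of size $m$ if there are elements $x_1\prec\cdots\prec x_m$ all chosen by Walker, chosen in this order in time. -}

module Defs where

open import Data.Nat using (ℕ)
open import Data.Product using (Σ; ∃; _×_; _,_)
open import Data.List using (List; []; _∷_; _++_; [_]; length)
open import Data.List.Relation.Unary.Linked using (Linked)
open import Data.List.Relation.Unary.All using (All)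
open import Data.List.Relation.Binary.Sublist.Propositional using (_⊆_)
import Data.List.Membership.Propositional as L
open import Relation.Binary.PropositionalEquality using (_≡_; _≢_)
open import Relation.Nullary using (¬_)
open import Data.Fin.Subset as S using (Subset)

IsChain : {A : Set} → (Elem : A → Set) → (_<_ : A → A → Set) → List A → Set
IsChain Elem _<_ xs = All Elem xs × Linked _<_ xs

-- Walker (whose choices, in time order, are `ws`) has built a chain of
-- size m: there are x₁ < ... < xₘ all chosen by Walker, chosen in this
-- order in time (i.e. forming a subsequence of ws).
Builds : {A : Set} → (_<_ : A → A → Set) → ℕ → List A → Set
Builds _<_ m ws = ∃ λ cs → length cs ≡ m × (cs ⊆ ws) × Linked _<_ cs

data Player : Set where
  walker blocker : Player

-- State: `ws` = Walker's choices in time order,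
-- `cs` = all elements chosen so far, `p` = player to move.
-- `WalkerWins Elem _<_ m ws cs p` : Walker has a strategy guaranteeing
-- that, once all elements are chosen, he has built a chain of size m.
data WalkerWins {A : Set} (Elem : A → Set) (_<_ : A → A → Set) (m : ℕ)
       : List A → List A → Player → Set where
  finished : ∀ {ws cs p} →
             (∀ x → Elem x → x L.∈ cs) →
             Builds _<_ m ws →
             WalkerWins Elem _<_ m ws cs p
  walk     : ∀ {ws cs} (x : A) → Elem x → ¬ (x L.∈ cs) →
             WalkerWins Elem _<_ m (ws ++ [ x ]) (x ∷ cs) blocker →
             WalkerWins Elem _<_ m ws cs walker
  block    : ∀ {ws cs} →
             (∃ λ x → Elem x × ¬ (x L.∈ cs)) →
             (∀ y → Elem y → ¬ (y L.∈ cs) →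
                WalkerWins Elem _<_ m ws (y ∷ cs) walker) →
             WalkerWins Elem _<_ m ws cs blocker

InP' : (d : ℕ) → Subset d → Set
InP' d x = (x ≢ S.⊥) × (x ≢ S.⊤)

_⊂_ : {d : ℕ} → Subset d → Subset d → Set
_⊂_ = S._⊂_

-- A chain in P' strictly increases in size, from at least 1 to at most d - 1, so it has at
-- most d - 1 elements; adding one point at a time to the empty set gives a chain of that length.
--
-- Walker keeps a set x such that his chain so far has exactly |x| elements, all contained in x,
-- and no chosen element lies strictly above x. When Blocker takes b, Walker takes a cover
-- y = x ∪ {i} of x with y ⊈ b: a point i outside b if x ⊆ b, any point outside x otherwise.
-- Then y is still free, it extends the chain, and nothing chosen lies strictly above y. After
-- d - 1 such moves Walker's chain is complete, and the rest of the game cannot spoil it.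

module Submission where

open import Defs
open import Data.Bool.Properties using () renaming (_≟_ to _≟ᵇ_)
open import Data.Empty using (⊥-elim)
open import Data.Fin using (zero; suc)
open import Data.Fin.Properties using (¬∀⟶∃¬)
open import Data.Fin.Subset using (Subset; inside; outside; ⊥; ⊤; ⁅_⁆; _∪_; ∣_∣; _∈_; _∉_; _⊆_; _⊈_)
open import Data.Fin.Subset.Properties
  using (_∈?_; _⊆?_; ∉⊥; ⊆⊤; ⊆-refl; ⊆-reflexive; ⊆-trans; ⊆-antisym; ⊆-⊂-trans; ⊂-trans; ⊂-irref;
         p⊂q⇒p⊆q; p⊂q⇒∣p∣<∣q∣; ∣p∣≤n; ∣⊥∣≡0; ∣⊤∣≡n; ∣p∣≡n⇒p≡⊤; ∪-identityʳ; p⊆p∪q; x∈p∪q⁺;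
         x∈⁅x⁆)
open import Data.List using (List; []; _∷_; _++_; [_]; _∷ʳ_; length; map; filter)
open import Data.List.Properties using (length-++; filter-notAll)
open import Data.List.Membership.Propositional using (lose) renaming (_∈_ to _∈ˡ_; _∉_ to _∉ˡ_)
open import Data.List.Membership.Propositional.Properties using (∈-filter⁺; ∈-++⁺ˡ; ∈-++⁺ʳ; ∈-map⁺)
open import Data.List.Relation.Unary.All as All using (All; []; _∷_)
open import Data.List.Relation.Unary.All.Properties using (∷ʳ⁺)
open import Data.List.Relation.Unary.Any using (Any; here; there; any?; satisfied)
open import Data.List.Relation.Unary.Linked as Linked using (Linked; []; [-]; _∷_)
import Data.List.Relation.Binary.Sublist.Propositional as Sublist
import Data.List.Relation.Binary.Sublist.Propositional.Properties as Sublistₚ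
open import Data.Nat using (ℕ; zero; suc; _+_; _∸_; _≤_; _<_; z≤n; s≤s)
open import Data.Nat.Induction using (<-wellFounded)
open import Data.Nat.Properties
  using (≤-reflexive; ≤∧≢⇒<; <-irrefl; ≤-pred; +-suc; +-comm; +-identityʳ; +-monoˡ-≤; m+n≤o⇒m≤o; n≢0⇒n>0;
         module ≤-Reasoning)
open import Data.Product using (∃; _×_; _,_; proj₁; proj₂)
open import Data.Sum using (_⊎_; inj₁; inj₂)
open import Data.Vec using ([]; _∷_; here; there)
open import Data.Vec.Properties using (≡-dec)
open import Function using (_∘_)
open import Induction.WellFounded using (Acc; acc)
open import Relation.Binary.Definitions using (DecidableEquality)
open import Relation.Binary.PropositionalEquality using (_≡_; _≢_; refl; sym; trans; cong; subst)
open import Relation.Nullary using (¬_; Dec; yes; no)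
open import Relation.Nullary.Decidable using (¬?; _×-dec_; decidable-stable)
open import Relation.Unary using (Decidable)

builds-∷ʳ : ∀ {A : Set} {_≺_ : A → A → Set} {m ws} y →
            Builds _≺_ m ws → Builds _≺_ m (ws ++ [ y ])
builds-∷ʳ y (cs , length≡m , cs⊆ws , linked) = cs , length≡m , Sublistₚ.++⁺ʳ [ y ] cs⊆ws , linked

module _ {A : Set} (_≟_ : DecidableEquality A) {Elem : A → Set} (Elem? : Decidable Elem) where

  open import Data.List.Membership.DecPropositional _≟_ using () renaming (_∈?_ to _∈?ˡ_)

  Available : List A → A → Set
  Available cs x = Elem x × x ∉ˡ cs

  -- The length of such a list L bounds the number of moves left, which makes the game finite.
  AvailableAmong : List A → List A → Set
  AvailableAmong cs L = ∀ {x} → Available cs x → x ∈ˡ L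

  availableAmong-∷ : ∀ {cs L y} → AvailableAmong cs L → Available cs y →
                     ∃ λ L′ → AvailableAmong (y ∷ cs) L′ × length L′ < length L
  availableAmong-∷ {cs} {L} {y} among y-available =
    filter (λ x → ¬? (x ≟ y)) L , among′ ,
    filter-notAll (λ x → ¬? (x ≟ y)) L (lose (among y-available) (λ y≢y → y≢y refl))
    where
    among′ : AvailableAmong (y ∷ cs) (filter (λ x → ¬? (x ≟ y)) L)
    among′ (ex , x∉y∷cs) = ∈-filter⁺ (λ x → ¬? (x ≟ y)) (among (ex , x∉y∷cs ∘ there)) (x∉y∷cs ∘ here)

  wins-once-built : ∀ {_≺_ : A → A → Set} {m ws cs} p L → AvailableAmong cs L →
                    Builds _≺_ m ws → WalkerWins Elem _≺_ m ws cs p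
  wins-once-built {_≺_} {m} p L among built = go p L among built (<-wellFounded (length L))
    where
    go : ∀ {ws cs} p L → AvailableAmong cs L → Builds _≺_ m ws → Acc _<_ (length L) →
         WalkerWins Elem _≺_ m ws cs p
    go {ws} {cs} p L among built (acc shorter) = play p (any? available? L)
      where
      available? : Decidable (Available cs)
      available? x = Elem? x ×-dec ¬? (x ∈?ˡ cs)

      next : ∀ {ws′ y} p′ → Available cs y → Builds _≺_ m ws′ → WalkerWins Elem _≺_ m ws′ (y ∷ cs) p′
      next p′ y-available built′ with (L′ , among′ , L′<L) ← availableAmong-∷ among y-available =
        go p′ L′ among′ built′ (shorter L′<L)

      play : ∀ p → Dec (Any (Available cs) L) → WalkerWins Elem _≺_ m ws cs p
      play p (no none) = finished all-chosen built
        where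
        all-chosen : ∀ x → Elem x → x ∈ˡ cs
        all-chosen x ex = decidable-stable (x ∈?ˡ cs) (λ x∉cs → none (lose (among (ex , x∉cs)) (ex , x∉cs)))
      play walker (yes some) with (y , y-available) ← satisfied some =
        walk y (proj₁ y-available) (proj₂ y-available) (next blocker y-available (builds-∷ʳ y built))
      play blocker (yes some) = block (satisfied some) (λ y ey y∉cs → next walker (ey , y∉cs) built)

subsets : ∀ n → List (Subset n)
subsets zero = [ [] ]
subsets (suc n) = map (inside ∷_) (subsets n) ++ map (outside ∷_) (subsets n)

∈-subsets : ∀ {n} (p : Subset n) → p ∈ˡ subsets n
∈-subsets [] = here refl
∈-subsets (inside ∷ p) = ∈-++⁺ˡ (∈-map⁺ (inside ∷_) (∈-subsets p))
∈-subsets {suc n} (outside ∷ p) = ∈-++⁺ʳ (map (inside ∷_) (subsets n)) (∈-map⁺ (outside ∷_) (∈-subsets p))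

∣p∣≡0⇒p≡⊥ : ∀ {n} (p : Subset n) → ∣ p ∣ ≡ 0 → p ≡ ⊥
∣p∣≡0⇒p≡⊥ [] _ = refl
∣p∣≡0⇒p≡⊥ (outside ∷ p) ∣p∣≡0 = cong (outside ∷_) (∣p∣≡0⇒p≡⊥ p ∣p∣≡0)

∣p∣<n⇒p≢⊤ : ∀ {n} {p : Subset n} → ∣ p ∣ < n → p ≢ ⊤
∣p∣<n⇒p≢⊤ {n} ∣p∣<n p≡⊤ = <-irrefl (trans (cong ∣_∣ p≡⊤) (∣⊤∣≡n n)) ∣p∣<n

p≢⊤⇒∃∉ : ∀ {n} {p : Subset n} → p ≢ ⊤ → ∃ (_∉ p)
p≢⊤⇒∃∉ {n} {p} p≢⊤ = ¬∀⟶∃¬ n (_∈ p) (_∈? p) (λ all∈ → p≢⊤ (⊆-antisym ⊆⊤ (λ {i} _ → all∈ i)))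

∣p∪⁅i⁆∣≡1+∣p∣ : ∀ {n} (p : Subset n) {i} → i ∉ p → ∣ p ∪ ⁅ i ⁆ ∣ ≡ suc ∣ p ∣
∣p∪⁅i⁆∣≡1+∣p∣ (inside ∷ p) {zero} i∉p = ⊥-elim (i∉p here)
∣p∪⁅i⁆∣≡1+∣p∣ (outside ∷ p) {zero} _ = cong (suc ∘ ∣_∣) (∪-identityʳ p)
∣p∪⁅i⁆∣≡1+∣p∣ (inside ∷ p) {suc i} i∉p = cong suc (∣p∪⁅i⁆∣≡1+∣p∣ p (i∉p ∘ there))
∣p∪⁅i⁆∣≡1+∣p∣ (outside ∷ p) {suc i} i∉p = ∣p∪⁅i⁆∣≡1+∣p∣ p (i∉p ∘ there)

infix 4 _⋖_

_⋖_ : ∀ {n} → Subset n → Subset n → Set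
p ⋖ q = p ⊂ q × ∣ q ∣ ≡ suc ∣ p ∣

p⋖p∪⁅i⁆ : ∀ {n} {p : Subset n} {i} → i ∉ p → p ⋖ p ∪ ⁅ i ⁆
p⋖p∪⁅i⁆ {p = p} {i} i∉p = (p⊆p∪q ⁅ i ⁆ , i , x∈p∪q⁺ (inj₂ (x∈⁅x⁆ i)) , i∉p) , ∣p∪⁅i⁆∣≡1+∣p∣ p i∉p

∃-⋖ : ∀ {n} {p : Subset n} → p ≢ ⊤ → ∃ (p ⋖_)
∃-⋖ p≢⊤ with (i , i∉p) ← p≢⊤⇒∃∉ p≢⊤ = _ , p⋖p∪⁅i⁆ i∉p

∃-⋖-⊈ : ∀ {n} {p q : Subset n} → p ≢ ⊤ → q ≢ ⊤ → ∃ λ r → p ⋖ r × r ⊈ q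
∃-⋖-⊈ {p = p} {q} p≢⊤ q≢⊤ with p ⊆? q
... | yes p⊆q with (i , i∉q) ← p≢⊤⇒∃∉ q≢⊤ =
  _ , p⋖p∪⁅i⁆ (i∉q ∘ p⊆q) , λ r⊆q → i∉q (r⊆q (x∈p∪q⁺ (inj₂ (x∈⁅x⁆ i))))
... | no p⊈q with (r , p⋖r) ← ∃-⋖ p≢⊤ =
  r , p⋖r , λ r⊆q → p⊈q (⊆-trans (p⊂q⇒p⊆q (proj₁ p⋖r)) r⊆q)

InP'⇒0<∣p∣ : ∀ {d} {p : Subset d} → InP' d p → 0 < ∣ p ∣
InP'⇒0<∣p∣ {p = p} (p≢⊥ , _) = n≢0⇒n>0 (p≢⊥ ∘ ∣p∣≡0⇒p≡⊥ p)

InP'⇒∣p∣<d : ∀ {d} {p : Subset d} → InP' d p → ∣ p ∣ < d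
InP'⇒∣p∣<d {p = p} (_ , p≢⊤) = ≤∧≢⇒< (∣p∣≤n p) (p≢⊤ ∘ ∣p∣≡n⇒p≡⊤)

InP'-⊃ : ∀ {d} {p q : Subset d} → p ⊂ q → ∣ q ∣ < d → InP' d q
InP'-⊃ (_ , i , i∈q , _) ∣q∣<d = (λ q≡⊥ → ∉⊥ (subst (_ ∈_) q≡⊥ i∈q)) , ∣p∣<n⇒p≢⊤ ∣q∣<d

module _ {k : ℕ} where

  room⇒∣p∣<1+k : ∀ (p : Subset (suc k)) {n} → ∣ p ∣ + n ≡ k → ∣ p ∣ < suc k
  room⇒∣p∣<1+k p room = s≤s (m+n≤o⇒m≤o ∣ p ∣ (≤-reflexive room))

  room⇒p≢⊤ : ∀ (p : Subset (suc k)) {n} → ∣ p ∣ + n ≡ k → p ≢ ⊤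
  room⇒p≢⊤ p = ∣p∣<n⇒p≢⊤ ∘ room⇒∣p∣<1+k p

  ⋖-InP' : ∀ {p q : Subset (suc k)} {n} → ∣ p ∣ + suc n ≡ k → p ⋖ q → InP' (suc k) q × ∣ q ∣ + n ≡ k
  ⋖-InP' {p} {q} {n} room (p⊂q , ∣q∣≡) = InP'-⊃ p⊂q (room⇒∣p∣<1+k q room′) , room′
    where
    room′ = trans (cong (_+ n) ∣q∣≡) (trans (sym (+-suc ∣ p ∣ n)) room)

head+length≤ : ∀ {A : Set} {R : A → A → Set} (f : A → ℕ) → (∀ {x y} → R x y → f x < f y) →
               ∀ {b x xs} → Linked R (x ∷ xs) → All (λ z → f z ≤ b) (x ∷ xs) → f x + length xs ≤ b
head+length≤ f f-mono {x = x} [-] (fx≤b ∷ []) = subst (_≤ _) (sym (+-identityʳ (f x))) fx≤b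
head+length≤ f f-mono {b} {x} {y ∷ ys} (Rxy ∷ linked) (_ ∷ fys≤b) = begin
  f x + suc (length ys)  ≡⟨ +-suc (f x) (length ys) ⟩
  suc (f x) + length ys  ≤⟨ +-monoˡ-≤ (length ys) (f-mono Rxy) ⟩
  f y + length ys        ≤⟨ head+length≤ f f-mono linked fys≤b ⟩
  b                      ∎
  where open ≤-Reasoning

linked-∷ʳ : ∀ {A : Set} {R : A → A → Set} {xs y} → Linked R xs → All (λ x → R x y) xs → Linked R (xs ∷ʳ y)
linked-∷ʳ [] [] = [-]
linked-∷ʳ [-] (Rxy ∷ []) = Rxy ∷ [-]
linked-∷ʳ (Rxx′ ∷ linked) (_ ∷ Rxs) = Rxx′ ∷ linked-∷ʳ linked Rxs

P'-chain-length≤ : ∀ {k} (xs : List (Subset (suc k))) → IsChain (InP' (suc k)) _⊂_ xs → length xs ≤ k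
P'-chain-length≤ [] _ = z≤n
P'-chain-length≤ {k} (x ∷ xs) (inP'@(x∈P' ∷ _) , linked) = begin
  suc (length xs)   ≤⟨ +-monoˡ-≤ (length xs) (InP'⇒0<∣p∣ x∈P') ⟩
  ∣ x ∣ + length xs  ≤⟨ head+length≤ ∣_∣ p⊂q⇒∣p∣<∣q∣ linked (All.map (≤-pred ∘ InP'⇒∣p∣<d) inP') ⟩
  k                 ∎
  where open ≤-Reasoning

P'-chain-above : ∀ {k} n (p : Subset (suc k)) → ∣ p ∣ + n ≡ k →
                 ∃ λ xs → length xs ≡ n × All (InP' (suc k)) xs × Linked _⊂_ (p ∷ xs)
P'-chain-above zero p _ = [] , refl , [] , [-]
P'-chain-above (suc n) p room =
  let (q , p⋖q) = ∃-⋖ (room⇒p≢⊤ p room)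
      (q∈P' , room′) = ⋖-InP' room p⋖q
      (xs , length≡n , xs∈P' , linked) = P'-chain-above n q room′
  in q ∷ xs , cong suc length≡n , q∈P' ∷ xs∈P' , proj₁ p⋖q ∷ linked

record ChainBelow {n} (x : Subset n) (ws : List (Subset n)) : Set where
  field
    chain    : List (Subset n)
    length≡  : length chain ≡ ∣ x ∣
    chain⊑ws : chain Sublist.⊆ ws
    linked   : Linked _⊂_ chain
    below    : All (_⊆ x) chain

chainBelow-⊥ : ∀ {n} → ChainBelow (⊥ {n}) []
chainBelow-⊥ {n} = record { chain = [] ; length≡ = sym (∣⊥∣≡0 n) ; chain⊑ws = Sublist.[] ; linked = [] ; below = [] }

chainBelow-⋖ : ∀ {n} {x y : Subset n} {ws} → ChainBelow x ws → x ⋖ y → ChainBelow y (ws ++ [ y ])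
chainBelow-⋖ {x = x} {y} c (x⊂y , ∣y∣≡) = record
  { chain    = chain ∷ʳ y
  ; length≡  = begin
      length (chain ++ [ y ])  ≡⟨ length-++ chain ⟩
      length chain + 1         ≡⟨ +-comm (length chain) 1 ⟩
      suc (length chain)       ≡⟨ cong suc length≡ ⟩
      suc ∣ x ∣                ≡⟨ sym ∣y∣≡ ⟩
      ∣ y ∣                    ∎
  ; chain⊑ws = Sublistₚ.++⁺ chain⊑ws Sublist.⊆-refl
  ; linked   = linked-∷ʳ linked (All.map {P = _⊆ x} (λ z⊆x → ⊆-⊂-trans z⊆x x⊂y) below)
  ; below    = ∷ʳ⁺ (All.map {P = _⊆ x} {Q = _⊆ y} (λ z⊆x → ⊆-trans z⊆x (p⊂q⇒p⊆q x⊂y)) below) ⊆-refl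
  }
  where
  open ChainBelow c
  open Relation.Binary.PropositionalEquality.≡-Reasoning

chainBelow⇒builds : ∀ {n} {x : Subset n} {ws m} → ChainBelow x ws → ∣ x ∣ ≡ m → Builds _⊂_ m ws
chainBelow⇒builds c ∣x∣≡m = chain , trans length≡ ∣x∣≡m , chain⊑ws , linked
  where open ChainBelow c

module _ {k : ℕ} where

  private
    Win : List (Subset (suc k)) → List (Subset (suc k)) → Player → Set
    Win = WalkerWins (InP' (suc k)) _⊂_ k

    InP'? : Decidable (InP' (suc k))
    InP'? p = ¬? (≡-dec _≟ᵇ_ p ⊥) ×-dec ¬? (≡-dec _≟ᵇ_ p ⊤)

  -- n is the number of moves Walker still needs, and b is Blocker's last move.
  blocker-to-move : ∀ n {x ws cs} → ∣ x ∣ + n ≡ k → ChainBelow x ws →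
                    All (λ z → ¬ x ⊂ z) cs → Win ws cs blocker
  walker-to-move : ∀ n {x ws cs} b → ∣ x ∣ + suc n ≡ k → b ≢ ⊤ → ChainBelow x ws →
                   All (λ z → ¬ x ⊂ z ⊎ z ≡ b) cs → Win ws cs walker

  blocker-to-move zero {x} room c _ =
    wins-once-built (≡-dec _≟ᵇ_) InP'? blocker (subsets (suc k)) (λ {p} _ → ∈-subsets p)
      (chainBelow⇒builds c (trans (sym (+-identityʳ ∣ x ∣)) room))
  blocker-to-move (suc n) {x} room c nothing-above with (y , x⋖y) ← ∃-⋖ (room⇒p≢⊤ x room) =
    block (y , proj₁ (⋖-InP' room x⋖y) , λ y∈cs → All.lookup nothing-above y∈cs (proj₁ x⋖y))
      (λ b b∈P' _ → walker-to-move n b room (proj₂ b∈P') c (inj₂ refl ∷ All.map inj₁ nothing-above))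

  walker-to-move n {x} {cs = cs} b room b≢⊤ c only-b-above
    with (y , x⋖y , y⊈b) ← ∃-⋖-⊈ (room⇒p≢⊤ x room) b≢⊤ =
    let (y∈P' , room′) = ⋖-InP' room x⋖y in
    walk y y∈P' y∉cs
      (blocker-to-move n room′ (chainBelow-⋖ c x⋖y) (⊂-irref refl ∷ All.map not-above only-b-above))
    where
    y∉cs : y ∉ˡ cs
    y∉cs y∈cs with All.lookup only-b-above y∈cs
    ... | inj₁ x⊄y = x⊄y (proj₁ x⋖y)
    ... | inj₂ y≡b = y⊈b (⊆-reflexive y≡b)

    not-above : ∀ {z} → ¬ x ⊂ z ⊎ z ≡ b → ¬ y ⊂ z
    not-above (inj₁ x⊄z) y⊂z = x⊄z (⊂-trans (proj₁ x⋖y) y⊂z)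
    not-above (inj₂ z≡b) y⊂z = y⊈b (⊆-trans (p⊂q⇒p⊆q y⊂z) (⊆-reflexive z≡b))

lemma3 : (d : ℕ) → 2 ≤ d →
    ((∃ λ (xs : List _) → IsChain (InP' d) _⊂_ xs × length xs ≡ d ∸ 1)
    × (∀ (xs : List _) → IsChain (InP' d) _⊂_ xs → length xs ≤ d ∸ 1))
    × WalkerWins (InP' d) _⊂_ (d ∸ 1) [] [] walker
    × WalkerWins (InP' d) _⊂_ (d ∸ 1) [] [] blocker
lemma3 (suc zero) (s≤s ())
lemma3 (suc (suc k)) _ =
  (longest-chain , P'-chain-length≤) ,
  -- Walker moves first as if Blocker had just taken ⊥.
  walker-to-move k ⊥ room (room⇒p≢⊤ ⊥ room) chainBelow-⊥ [] ,
  blocker-to-move (suc k) room chainBelow-⊥ []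
  where
  room : ∣ ⊥ {suc (suc k)} ∣ + suc k ≡ suc k
  room = cong (_+ suc k) (∣⊥∣≡0 (suc (suc k)))

  longest-chain : ∃ λ xs → IsChain (InP' (suc (suc k))) _⊂_ xs × length xs ≡ suc k
  longest-chain with (xs , length≡ , xs∈P' , linked) ← P'-chain-above (suc k) ⊥ room =
    xs , (xs∈P' , Linked.tail linked) , length≡
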